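{- Let $G$ be a graph without isolated vertices with $\delta(G)=\sigma(G)=2$, and suppose there is a sum labelling $\lambda$ of $H=G+N_2$ such that $\lambda(V(H))$ contains a non-trivial arithmetic progression. Then there is a sum labelling $\lambda'$ of $H'=G+C_4+N_2$ such that $\lambda'(V(H'))$ contains a non-trivial arithmetic progression.
   Context: A graph $H=(V,E)$ is a sum graph if there is an injective map $\lambda:V\to\mathbb{N}$ (a sum labelling) such that $E=\{xy : \exists z\in V,\ \lambda(z)=\lambda(x)+\lambda(y)\}$. For a graph $G$ without isolated vertices, $\sigma(G)$ is the minimum $k$ such that $G+N_k$ is a sum graph ($N_k$: $k$ isolated vertices, $+$: disjoint union); $\delta(G)$ is the minimum degree. A set $L$ of labels contains a non-trivial arithmetic progression if there are positive integers $x,d$ with $x,x+d,x+2d\in L$ and $d\notin L$. -}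

module Defs where

open import Data.Nat using (ℕ; zero; suc; _+_; _≤_; _<_)
open import Data.Fin using (Fin; zero; suc; splitAt)
open import Data.Bool using (Bool; true; false; if_then_else_)
open import Data.List using (List; map; allFin)
open import Data.Nat.ListAction using (sum)
open import Data.Sum using (_⊎_; inj₁; inj₂)
open import Data.Product using (Σ; ∃; _×_; _,_)
open import Relation.Binary.PropositionalEquality using (_≡_; _≢_; refl)
open import Relation.Nullary using (¬_)
open import Function.Definitions using (Injective)
open import Function.Bundles using (_⇔_)

record Graph (n : ℕ) : Set where
  field
    Adj     : Fin n → Fin n → Bool
    sym     : ∀ i j → Adj i j ≡ Adj j i
    irrefl  : ∀ i → Adj i i ≡ false
open Graph public

module _ {n m : ℕ} where
  sumAdj : (Fin n → Fin n → Bool) → (Fin m → Fin m → Bool)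
         → Fin n ⊎ Fin m → Fin n ⊎ Fin m → Bool
  sumAdj A B (inj₁ a) (inj₁ b) = A a b
  sumAdj A B (inj₂ a) (inj₂ b) = B a b
  sumAdj A B (inj₁ a) (inj₂ b) = false
  sumAdj A B (inj₂ a) (inj₁ b) = false

  sumAdj-sym : (G : Graph n) (H : Graph m) → ∀ x y
             → sumAdj (Adj G) (Adj H) x y ≡ sumAdj (Adj G) (Adj H) y x
  sumAdj-sym G H (inj₁ a) (inj₁ b) = sym G a b
  sumAdj-sym G H (inj₂ a) (inj₂ b) = sym H a b
  sumAdj-sym G H (inj₁ a) (inj₂ b) = refl
  sumAdj-sym G H (inj₂ a) (inj₁ b) = refl

  sumAdj-irrefl : (G : Graph n) (H : Graph m) → ∀ x
                → sumAdj (Adj G) (Adj H) x x ≡ false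
  sumAdj-irrefl G H (inj₁ a) = irrefl G a
  sumAdj-irrefl G H (inj₂ a) = irrefl H a

infixl 6 _⊕_
_⊕_ : ∀ {n m} → Graph n → Graph m → Graph (n + m)
_⊕_ {n} G H = record
  { Adj    = λ i j → sumAdj (Adj G) (Adj H) (splitAt n i) (splitAt n j)
  ; sym    = λ i j → sumAdj-sym G H (splitAt n i) (splitAt n j)
  ; irrefl = λ i → sumAdj-irrefl G H (splitAt n i)
  }

N : (k : ℕ) → Graph k
N k = record { Adj = λ _ _ → false ; sym = λ _ _ → refl ; irrefl = λ _ → refl }

c4Adj : Fin 4 → Fin 4 → Bool
c4Adj zero zero = false
c4Adj zero (suc zero) = true
c4Adj zero (suc (suc zero)) = false
c4Adj zero (suc (suc (suc zero))) = true
c4Adj (suc zero) zero = true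
c4Adj (suc zero) (suc zero) = false
c4Adj (suc zero) (suc (suc zero)) = true
c4Adj (suc zero) (suc (suc (suc zero))) = false
c4Adj (suc (suc zero)) zero = false
c4Adj (suc (suc zero)) (suc zero) = true
c4Adj (suc (suc zero)) (suc (suc zero)) = false
c4Adj (suc (suc zero)) (suc (suc (suc zero))) = true
c4Adj (suc (suc (suc zero))) zero = true
c4Adj (suc (suc (suc zero))) (suc zero) = false
c4Adj (suc (suc (suc zero))) (suc (suc zero)) = true
c4Adj (suc (suc (suc zero))) (suc (suc (suc zero))) = false

c4-sym : ∀ i j → c4Adj i j ≡ c4Adj j i
c4-sym zero zero = refl
c4-sym zero (suc zero) = refl
c4-sym zero (suc (suc zero)) = refl
c4-sym zero (suc (suc (suc zero))) = refl
c4-sym (suc zero) zero = refl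
c4-sym (suc zero) (suc zero) = refl
c4-sym (suc zero) (suc (suc zero)) = refl
c4-sym (suc zero) (suc (suc (suc zero))) = refl
c4-sym (suc (suc zero)) zero = refl
c4-sym (suc (suc zero)) (suc zero) = refl
c4-sym (suc (suc zero)) (suc (suc zero)) = refl
c4-sym (suc (suc zero)) (suc (suc (suc zero))) = refl
c4-sym (suc (suc (suc zero))) zero = refl
c4-sym (suc (suc (suc zero))) (suc zero) = refl
c4-sym (suc (suc (suc zero))) (suc (suc zero)) = refl
c4-sym (suc (suc (suc zero))) (suc (suc (suc zero))) = refl

c4-irrefl : ∀ i → c4Adj i i ≡ false
c4-irrefl zero = refl
c4-irrefl (suc zero) = refl
c4-irrefl (suc (suc zero)) = refl
c4-irrefl (suc (suc (suc zero))) = refl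

C4 : Graph 4
C4 = record { Adj = c4Adj ; sym = c4-sym ; irrefl = c4-irrefl }

degree : ∀ {n} → Graph n → Fin n → ℕ
degree {n} G v = sum (map (λ w → if Adj G v w then 1 else 0) (allFin n))

MinDegreeIs : ∀ {n} → Graph n → ℕ → Set
MinDegreeIs G d = (∀ v → d ≤ degree G v) × ∃ λ v → degree G v ≡ d

NoIsolated : ∀ {n} → Graph n → Set
NoIsolated G = ∀ v → ∃ λ w → Adj G v w ≡ true

IsSumLabelling : ∀ {n} → Graph n → (Fin n → ℕ) → Set
IsSumLabelling G lab =
  Injective _≡_ _≡_ lab ×
  (∀ v → 1 ≤ lab v) ×
  (∀ x y → x ≢ y → (Adj G x y ≡ true ⇔ ∃ λ z → lab z ≡ lab x + lab y))

IsSumGraph : ∀ {n} → Graph n → Set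
IsSumGraph G = ∃ λ lab → IsSumLabelling G lab

SumNumberIs : ∀ {n} → Graph n → ℕ → Set
SumNumberIs G k = IsSumGraph (G ⊕ N k) × (∀ j → j < k → ¬ IsSumGraph (G ⊕ N j))

InLabels : ∀ {n} → (Fin n → ℕ) → ℕ → Set
InLabels lab a = ∃ λ v → lab v ≡ a

HasNonTrivialAP : ∀ {n} → (Fin n → ℕ) → Set
HasNonTrivialAP lab = Σ ℕ λ x → Σ ℕ λ d →
  1 ≤ x × 1 ≤ d ×
  InLabels lab x × InLabels lab (x + d) × InLabels lab (x + d + d) ×
  ¬ InLabels lab d

Fin-labels : ∀ {n} → Graph n → Set
Fin-labels {n} _ = Fin n → ℕ

-- Scale the old labels by 4 and give the 4-cycle c₀c₁c₂c₃ the odd labels 1, 4x − 1, 4d + 1,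
-- 4(x + d) − 1. The cycle edges then sum to 4x, 4(x + d), 4(x + 2d), 4(x + d): the scaled
-- progression, which consists of labels. Sums of non-adjacent cycle vertices are ≡ 2 (mod 4), so
-- never labels, and two scaled old labels sum to a label exactly when the old ones did. An old
-- label 4ℓ plus a cycle label can only hit the other cycle label of the same residue, which lies
-- 4d higher; this forces ℓ = d, excluded since d is not a label. The progression 4x, 4(x + d),
-- 4(x + 2d) has difference 4d, again not a label. Finally G + C₄ + N₂ ≅ (G + N₂) + C₄.
module Submission where

open import Defs hiding (sym)
open import Data.Nat using (ℕ; suc; _+_; _*_; _≤_; _<_; z≤n; s≤s; NonZero)
open import Data.Nat.Properties
  using ( +-comm; +-assoc; +-identityʳ; +-cancelˡ-≡; +-cancelʳ-≡; *-cancelʳ-≡; *-distribʳ-+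
        ; <⇒≢; m<n+m; m≤m+n; m≤m*n; ≤-trans)
open import Data.Nat.DivMod using (_%_; [m+kn]%n≡m%n; m<n⇒m%n≡m)
open import Data.Nat.Tactic.RingSolver using (solve-∀)
open import Data.Fin using (Fin; splitAt; join)
open import Data.Fin.Patterns using (0F; 1F; 2F; 3F)
open import Data.Fin.Properties using (+↔⊎; splitAt-join)
open import Data.Bool using (Bool; true; false)
open import Data.Empty using (⊥-elim)
open import Data.Sum using (_⊎_; inj₁; inj₂)
open import Data.Sum.Algebra using (⊎-cong; ⊎-comm; ⊎-assoc)
open import Data.Product using (Σ; ∃; _×_; _,_; proj₁; proj₂)
open import Function using (_∘_)
open import Function.Bundles using (Inverse; Injection; Equivalence; _↔_; _⇔_; mk⇔)
open import Function.Definitions using (Injective)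
open import Function.Properties.Inverse using (↔-refl; ↔-sym; ↔-trans; ↔⇒↣)
open import Relation.Binary.PropositionalEquality
open import Relation.Nullary using (¬_)

open Inverse using (to; from; strictlyInverseˡ)

IsSumLabellingOn : {V : Set} → (V → V → Bool) → (V → ℕ) → Set
IsSumLabellingOn R lab =
  Injective _≡_ _≡_ lab ×
  (∀ v → 1 ≤ lab v) ×
  (∀ x y → x ≢ y → (R x y ≡ true ⇔ ∃ λ z → lab z ≡ lab x + lab y))

module _ {V W : Set} (e : V ↔ W) where

  label-transport : ∀ {lab : W → ℕ} {a} → (∃ λ w → lab w ≡ a) → ∃ λ v → lab (to e v) ≡ a
  label-transport {lab} (w , p) = from e w , trans (cong lab (strictlyInverseˡ e w)) p

  isSumLabellingOn-transport : ∀ {R S lab} → (∀ x y → R x y ≡ S (to e x) (to e y))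
    → IsSumLabellingOn S lab → IsSumLabellingOn R (lab ∘ to e)
  isSumLabellingOn-transport {R} {S} {lab} R≡S (lab-injective , lab-positive , lab-sums) =
    lab-injective′ , lab-positive ∘ to e , lab-sums′
    where
    to-injective : Injective _≡_ _≡_ (to e)
    to-injective = Injection.injective (↔⇒↣ e)

    lab-injective′ : Injective _≡_ _≡_ (lab ∘ to e)
    lab-injective′ = to-injective ∘ lab-injective

    lab-sums′ : ∀ x y → x ≢ y → (R x y ≡ true ⇔ ∃ λ z → lab (to e z) ≡ lab (to e x) + lab (to e y))
    lab-sums′ x y x≢y = mk⇔
      (λ adj → label-transport (Equivalence.to iff (trans (sym (R≡S x y)) adj)))
      (λ (z , p) → trans (R≡S x y) (Equivalence.from iff (to e z , p)))
      where iff = lab-sums (to e x) (to e y) (x≢y ∘ to-injective)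

APSumLabelling : ∀ {n} → Graph n → Set
APSumLabelling G = Σ (Fin-labels G) λ lab → IsSumLabelling G lab × HasNonTrivialAP lab

apSumLabelling-transport : ∀ {k k′} {G : Graph k} {G′ : Graph k′} (e : Fin k ↔ Fin k′)
  → (∀ x y → Adj G x y ≡ Adj G′ (to e x) (to e y)) → APSumLabelling G′ → APSumLabelling G
apSumLabelling-transport e G≡G′ (lab , isSum , (x , d , 1≤x , 1≤d , x∈ , x+d∈ , x+2d∈ , d∉)) =
  lab ∘ to e , isSumLabellingOn-transport e G≡G′ isSum ,
  (x , d , 1≤x , 1≤d , label-transport e x∈ , label-transport e x+d∈ , label-transport e x+2d∈ ,
   λ (v , p) → d∉ (to e v , p))

Adj-⊕-join : ∀ {n m} (G : Graph n) (H : Graph m) p q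
  → Adj (G ⊕ H) (join n m p) (join n m q) ≡ sumAdj (Adj G) (Adj H) p q
Adj-⊕-join {n} {m} G H p q rewrite splitAt-join n m p | splitAt-join n m q = refl

module _ {n a b : ℕ} where

  ⊕-swap↔ : Fin (n + a + b) ↔ Fin (n + b + a)
  ⊕-swap↔ =
    ↔-trans (+↔⊎ {n + a}) (↔-trans (⊎-cong (+↔⊎ {n}) ↔-refl) (↔-trans (⊎-assoc _ _ _ _)
    (↔-trans (⊎-cong ↔-refl (⊎-comm _ _)) (↔-trans (↔-sym (⊎-assoc _ _ _ _))
    (↔-trans (⊎-cong (↔-sym (+↔⊎ {n})) ↔-refl) (↔-sym (+↔⊎ {n + b})))))))

  Adj-⊕-⊕-join : (G : Graph n) (A : Graph a) (B : Graph b) → ∀ p q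
    → Adj (G ⊕ B ⊕ A) (join (n + b) a (inj₁ (join n b p))) (join (n + b) a (inj₁ (join n b q)))
      ≡ sumAdj (Adj G) (Adj B) p q
  Adj-⊕-⊕-join G A B p q = trans (Adj-⊕-join (G ⊕ B) A (inj₁ _) (inj₁ _)) (Adj-⊕-join G B p q)

  ⊕-swap-adj : (G : Graph n) (A : Graph a) (B : Graph b)
    → ∀ x y → Adj (G ⊕ A ⊕ B) x y ≡ Adj (G ⊕ B ⊕ A) (to ⊕-swap↔ x) (to ⊕-swap↔ y)
  ⊕-swap-adj G A B x y with splitAt (n + a) x | splitAt (n + a) y
  ... | inj₁ i | inj₁ j with splitAt n i | splitAt n j
  ...   | inj₁ g | inj₁ h = sym (Adj-⊕-⊕-join G A B (inj₁ g) (inj₁ h))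
  ...   | inj₁ g | inj₂ c = sym (Adj-⊕-join (G ⊕ B) A (inj₁ _) (inj₂ c))
  ...   | inj₂ c | inj₁ h = sym (Adj-⊕-join (G ⊕ B) A (inj₂ c) (inj₁ _))
  ...   | inj₂ c | inj₂ c′ = sym (Adj-⊕-join (G ⊕ B) A (inj₂ c) (inj₂ c′))
  ⊕-swap-adj G A B x y | inj₁ i | inj₂ k with splitAt n i
  ... | inj₁ g = sym (Adj-⊕-⊕-join G A B (inj₁ g) (inj₂ k))
  ... | inj₂ c = sym (Adj-⊕-join (G ⊕ B) A (inj₂ c) (inj₁ _))
  ⊕-swap-adj G A B x y | inj₂ k | inj₁ i with splitAt n i
  ... | inj₁ g = sym (Adj-⊕-⊕-join G A B (inj₂ k) (inj₁ g))
  ... | inj₂ c = sym (Adj-⊕-join (G ⊕ B) A (inj₁ _) (inj₂ c))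
  ⊕-swap-adj G A B x y | inj₂ k | inj₂ k′ = sym (Adj-⊕-⊕-join G A B (inj₂ k) (inj₂ k′))

  apSumLabelling-⊕-swap : (G : Graph n) (A : Graph a) (B : Graph b)
    → APSumLabelling (G ⊕ B ⊕ A) → APSumLabelling (G ⊕ A ⊕ B)
  apSumLabelling-⊕-swap G A B =
    apSumLabelling-transport {G = G ⊕ A ⊕ B} {G ⊕ B ⊕ A} ⊕-swap↔ (⊕-swap-adj G A B)

divMod-unique : ∀ {k r r′ q q′} .{{_ : NonZero k}} → r < k → r′ < k
  → r + q * k ≡ r′ + q′ * k → r ≡ r′ × q ≡ q′
divMod-unique {k} {r} {r′} {q} {q′} r<k r′<k eq =
  r≡r′ , *-cancelʳ-≡ q q′ k (+-cancelˡ-≡ r _ _ (trans eq (cong (_+ q′ * k) (sym r≡r′))))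
  where
  open ≡-Reasoning
  r≡r′ : r ≡ r′
  r≡r′ = begin
    r                 ≡⟨ m<n⇒m%n≡m r<k ⟨
    r % k             ≡⟨ [m+kn]%n≡m%n r q k ⟨
    (r + q * k) % k   ≡⟨ cong (_% k) eq ⟩
    (r′ + q′ * k) % k ≡⟨ [m+kn]%n≡m%n r′ q′ k ⟩
    r′ % k            ≡⟨ m<n⇒m%n≡m r′<k ⟩
    r′                ∎

n≢k+n : ∀ {k} n → 1 ≤ k → n ≢ k + n
n≢k+n n 1≤k = <⇒≢ (m<n+m n 1≤k)

[1+a*4]+[1+b*4] : ∀ a b → (1 + a * 4) + (1 + b * 4) ≡ 2 + (a + b) * 4
[1+a*4]+[1+b*4] = solve-∀

[3+a*4]+[3+b*4] : ∀ a b → (3 + a * 4) + (3 + b * 4) ≡ 2 + suc (a + b) * 4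
[3+a*4]+[3+b*4] = solve-∀

[1+a*4]+[3+b*4] : ∀ a b → (1 + a * 4) + (3 + b * 4) ≡ suc (a + b) * 4
[1+a*4]+[3+b*4] = solve-∀

[3+a*4]+[1+b*4] : ∀ a b → (3 + a * 4) + (1 + b * 4) ≡ suc (a + b) * 4
[3+a*4]+[1+b*4] = solve-∀

a*4+[r+b*4] : ∀ a r b → a * 4 + (r + b * 4) ≡ r + (a + b) * 4
a*4+[r+b*4] = solve-∀

[a+b+b]*4 : ∀ a b → (a + b + b) * 4 ≡ a * 4 + b * 4 + b * 4
[a+b+b]*4 = solve-∀

module AddC4 {m : ℕ} (H : Graph m) (lab : Fin m → ℕ)
             (lab-injective : Injective _≡_ _≡_ lab) (lab-positive : ∀ v → 1 ≤ lab v)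
             (lab-sums : ∀ u v → u ≢ v → (Adj H u v ≡ true ⇔ ∃ λ z → lab z ≡ lab u + lab v))
             (x′ d : ℕ) (1≤d : 1 ≤ d)
             (x∈ : InLabels lab (suc x′)) (x+d∈ : InLabels lab (suc x′ + d))
             (x+2d∈ : InLabels lab (suc x′ + d + d)) (d∉ : ¬ InLabels lab d) where

  V : Set
  V = Fin m ⊎ Fin 4

  residue : V → ℕ
  residue (inj₁ _)  = 0
  residue (inj₂ 0F) = 1
  residue (inj₂ 1F) = 3
  residue (inj₂ 2F) = 1
  residue (inj₂ 3F) = 3

  -- With x = suc x′, the cycle labels 4x − 1 and 4(x + d) − 1 are 3 + 4x′ and 3 + 4(x′ + d).
  quotient : V → ℕ
  quotient (inj₁ u)  = lab u
  quotient (inj₂ 0F) = 0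
  quotient (inj₂ 1F) = x′
  quotient (inj₂ 2F) = d
  quotient (inj₂ 3F) = x′ + d

  label : V → ℕ
  label w = residue w + quotient w * 4

  residue<4 : ∀ w → residue w < 4
  residue<4 (inj₁ _)  = s≤s z≤n
  residue<4 (inj₂ 0F) = s≤s (s≤s z≤n)
  residue<4 (inj₂ 1F) = s≤s (s≤s (s≤s (s≤s z≤n)))
  residue<4 (inj₂ 2F) = s≤s (s≤s z≤n)
  residue<4 (inj₂ 3F) = s≤s (s≤s (s≤s (s≤s z≤n)))

  residue-inj₂≢0 : ∀ c → residue (inj₂ c) ≢ 0
  residue-inj₂≢0 0F ()
  residue-inj₂≢0 1F ()
  residue-inj₂≢0 2F ()
  residue-inj₂≢0 3F ()

  residue≢2 : ∀ w → residue w ≢ 2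
  residue≢2 (inj₁ _)  ()
  residue≢2 (inj₂ 0F) ()
  residue≢2 (inj₂ 1F) ()
  residue≢2 (inj₂ 2F) ()
  residue≢2 (inj₂ 3F) ()

  label≡⇒residue×quotient : ∀ w {r q} → r < 4 → label w ≡ r + q * 4 → residue w ≡ r × quotient w ≡ q
  label≡⇒residue×quotient w r<4 = divMod-unique (residue<4 w) r<4

  label≡*4⇒inLabels : ∀ w {q} → label w ≡ q * 4 → InLabels lab q
  label≡*4⇒inLabels (inj₁ u) {q} eq =
    u , proj₂ (label≡⇒residue×quotient (inj₁ u) {0} {q} (s≤s z≤n) eq)
  label≡*4⇒inLabels (inj₂ c) {q} eq =
    ⊥-elim (residue-inj₂≢0 c (proj₁ (label≡⇒residue×quotient (inj₂ c) {0} {q} (s≤s z≤n) eq)))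

  c4-same-residue : ∀ c c′ → residue (inj₂ c) ≡ residue (inj₂ c′)
    → c ≡ c′ ⊎ quotient (inj₂ c′) ≡ d + quotient (inj₂ c) ⊎ quotient (inj₂ c) ≡ d + quotient (inj₂ c′)
  c4-same-residue 0F 0F _ = inj₁ refl
  c4-same-residue 0F 1F ()
  c4-same-residue 0F 2F _ = inj₂ (inj₁ (sym (+-identityʳ d)))
  c4-same-residue 0F 3F ()
  c4-same-residue 1F 0F ()
  c4-same-residue 1F 1F _ = inj₁ refl
  c4-same-residue 1F 2F ()
  c4-same-residue 1F 3F _ = inj₂ (inj₁ (+-comm x′ d))
  c4-same-residue 2F 0F _ = inj₂ (inj₂ (sym (+-identityʳ d)))
  c4-same-residue 2F 1F ()
  c4-same-residue 2F 2F _ = inj₁ refl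
  c4-same-residue 2F 3F ()
  c4-same-residue 3F 0F ()
  c4-same-residue 3F 1F _ = inj₂ (inj₂ (+-comm x′ d))
  c4-same-residue 3F 2F ()
  c4-same-residue 3F 3F _ = inj₁ refl

  residue-quotient-injective : ∀ w w′ → residue w ≡ residue w′ × quotient w ≡ quotient w′ → w ≡ w′
  residue-quotient-injective (inj₁ u) (inj₁ v) (_ , q≡) = cong inj₁ (lab-injective q≡)
  residue-quotient-injective (inj₁ u) (inj₂ c) (r≡ , _) = ⊥-elim (residue-inj₂≢0 c (sym r≡))
  residue-quotient-injective (inj₂ c) (inj₁ u) (r≡ , _) = ⊥-elim (residue-inj₂≢0 c r≡)
  residue-quotient-injective (inj₂ c) (inj₂ c′) (r≡ , q≡) with c4-same-residue c c′ r≡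
  ... | inj₁ c≡c′          = cong inj₂ c≡c′
  ... | inj₂ (inj₁ q′≡d+q) = ⊥-elim (n≢k+n _ 1≤d (trans q≡ q′≡d+q))
  ... | inj₂ (inj₂ q≡d+q′) = ⊥-elim (n≢k+n _ 1≤d (trans (sym q≡) q≡d+q′))

  label-injective : Injective _≡_ _≡_ label
  label-injective {w} {w′} eq =
    residue-quotient-injective w w′ (label≡⇒residue×quotient w (residue<4 w′) eq)

  label-positive : ∀ w → 1 ≤ label w
  label-positive (inj₁ u)  = ≤-trans (lab-positive u) (m≤m*n (lab u) 4)
  label-positive (inj₂ 0F) = s≤s z≤n
  label-positive (inj₂ 1F) = s≤s z≤n
  label-positive (inj₂ 2F) = s≤s z≤n
  label-positive (inj₂ 3F) = s≤s z≤n

  LabelSum : V → V → Set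
  LabelSum w w′ = ∃ λ z → label z ≡ label w + label w′

  scaled-label : ∀ {k s} → InLabels lab k → s ≡ k * 4 → ∃ λ z → label z ≡ s
  scaled-label (u , p) eq = inj₁ u , trans (cong (_* 4) p) (sym eq)

  old-sum⇔ : ∀ u v → u ≢ v → (Adj H u v ≡ true ⇔ LabelSum (inj₁ u) (inj₁ v))
  old-sum⇔ u v u≢v = mk⇔
    (λ adj → let z , p = Equivalence.to iff adj in
      inj₁ z , trans (cong (_* 4) p) (*-distribʳ-+ 4 (lab u) (lab v)))
    (λ (z , p) → Equivalence.from iff
      (label≡*4⇒inLabels z {lab u + lab v} (trans p (sym (*-distribʳ-+ 4 (lab u) (lab v))))))
    where iff = lab-sums u v u≢v

  ¬old+c4-sum : ∀ u c → ¬ LabelSum (inj₁ u) (inj₂ c)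
  ¬old+c4-sum u c (z , p)
    with label≡⇒residue×quotient z {q = lab u + quotient (inj₂ c)} (residue<4 (inj₂ c))
           (trans p (a*4+[r+b*4] (lab u) (residue (inj₂ c)) (quotient (inj₂ c))))
  ¬old+c4-sum u c (inj₁ _ , _)  | r≡ , _  = residue-inj₂≢0 c (sym r≡)
  ¬old+c4-sum u c (inj₂ c″ , _) | r≡ , q≡ with c4-same-residue c c″ (sym r≡)
  ... | inj₁ refl          = n≢k+n _ (lab-positive u) q≡
  ... | inj₂ (inj₁ q″≡d+q) = d∉ (u , +-cancelʳ-≡ _ _ _ (trans (sym q≡) q″≡d+q))
  ... | inj₂ (inj₂ q≡d+q″) = n≢k+n _ (≤-trans 1≤d (m≤m+n d (lab u)))
    (trans q≡d+q″ (trans (cong (d +_) q≡) (sym (+-assoc d (lab u) _))))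

  c4-edge⇔ : ∀ c c′ → LabelSum (inj₂ c) (inj₂ c′) → (true ≡ true ⇔ LabelSum (inj₂ c) (inj₂ c′))
  c4-edge⇔ _ _ s = mk⇔ (λ _ → s) (λ _ → refl)

  c4-nonedge⇔ : ∀ c c′ q → label (inj₂ c) + label (inj₂ c′) ≡ 2 + q * 4
    → (false ≡ true ⇔ LabelSum (inj₂ c) (inj₂ c′))
  c4-nonedge⇔ _ _ q eq = mk⇔ (λ ()) (λ (z , p) → ⊥-elim (residue≢2 z
    (proj₁ (label≡⇒residue×quotient z {q = q} (s≤s (s≤s (s≤s z≤n))) (trans p eq)))))

  c4-sum⇔-sym : ∀ c c′ → (c4Adj c c′ ≡ true ⇔ LabelSum (inj₂ c) (inj₂ c′))
    → (c4Adj c′ c ≡ true ⇔ LabelSum (inj₂ c′) (inj₂ c))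
  c4-sum⇔-sym c c′ iff = mk⇔
    (λ adj → let z , p = Equivalence.to iff (trans (c4-sym c c′) adj) in
      z , trans p (+-comm (label (inj₂ c)) _))
    (λ (z , p) → trans (c4-sym c′ c) (Equivalence.from iff (z , trans p (+-comm (label (inj₂ c′)) _))))

  c4-sum⇔ : ∀ c c′ → (c4Adj c c′ ≡ true ⇔ LabelSum (inj₂ c) (inj₂ c′))
  c4-sum⇔ 0F 0F = c4-nonedge⇔ 0F 0F 0 refl
  c4-sum⇔ 0F 1F = c4-edge⇔ 0F 1F (scaled-label x∈ ([1+a*4]+[3+b*4] 0 x′))
  c4-sum⇔ 0F 2F = c4-nonedge⇔ 0F 2F d refl
  c4-sum⇔ 0F 3F = c4-edge⇔ 0F 3F (scaled-label x+d∈ ([1+a*4]+[3+b*4] 0 (x′ + d)))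
  c4-sum⇔ 1F 0F = c4-sum⇔-sym 0F 1F (c4-sum⇔ 0F 1F)
  c4-sum⇔ 1F 1F = c4-nonedge⇔ 1F 1F (suc (x′ + x′)) ([3+a*4]+[3+b*4] x′ x′)
  c4-sum⇔ 1F 2F = c4-edge⇔ 1F 2F (scaled-label x+d∈ ([3+a*4]+[1+b*4] x′ d))
  c4-sum⇔ 1F 3F = c4-nonedge⇔ 1F 3F (suc (x′ + (x′ + d))) ([3+a*4]+[3+b*4] x′ (x′ + d))
  c4-sum⇔ 2F 0F = c4-sum⇔-sym 0F 2F (c4-sum⇔ 0F 2F)
  c4-sum⇔ 2F 1F = c4-sum⇔-sym 1F 2F (c4-sum⇔ 1F 2F)
  c4-sum⇔ 2F 2F = c4-nonedge⇔ 2F 2F (d + d) ([1+a*4]+[1+b*4] d d)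
  c4-sum⇔ 2F 3F = c4-edge⇔ 2F 3F (scaled-label x+2d∈
    (trans ([1+a*4]+[3+b*4] d (x′ + d)) (cong (λ t → suc t * 4) (+-comm d (x′ + d)))))
  c4-sum⇔ 3F 0F = c4-sum⇔-sym 0F 3F (c4-sum⇔ 0F 3F)
  c4-sum⇔ 3F 1F = c4-sum⇔-sym 1F 3F (c4-sum⇔ 1F 3F)
  c4-sum⇔ 3F 2F = c4-sum⇔-sym 2F 3F (c4-sum⇔ 2F 3F)
  c4-sum⇔ 3F 3F = c4-nonedge⇔ 3F 3F (suc (x′ + d + (x′ + d))) ([3+a*4]+[3+b*4] (x′ + d) (x′ + d))

  label-sums : ∀ w w′ → w ≢ w′ → (sumAdj (Adj H) c4Adj w w′ ≡ true ⇔ LabelSum w w′)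
  label-sums (inj₁ u) (inj₁ v) w≢w′ = old-sum⇔ u v (w≢w′ ∘ cong inj₁)
  label-sums (inj₁ u) (inj₂ c) _    = mk⇔ (λ ()) (⊥-elim ∘ ¬old+c4-sum u c)
  label-sums (inj₂ c) (inj₁ u) _    = mk⇔ (λ ())
    (λ (z , p) → ⊥-elim (¬old+c4-sum u c (z , trans p (+-comm (label (inj₂ c)) _))))
  label-sums (inj₂ c) (inj₂ c′) _   = c4-sum⇔ c c′

  apSumLabelling : APSumLabelling (H ⊕ C4)
  apSumLabelling =
    label ∘ splitAt m ,
    isSumLabellingOn-transport +↔⊎ (λ _ _ → refl) (label-injective , label-positive , label-sums) ,
    (suc x′ * 4 , d * 4 , s≤s z≤n , ≤-trans 1≤d (m≤m*n d 4) ,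
     label-transport +↔⊎ (scaled-label x∈ refl) ,
     label-transport +↔⊎ (scaled-label x+d∈ (sym (*-distribʳ-+ 4 (suc x′) d))) ,
     label-transport +↔⊎ (scaled-label x+2d∈ (sym ([a+b+b]*4 (suc x′) d))) ,
     λ (i , p) → d∉ (label≡*4⇒inLabels (splitAt m i) p))

apSumLabelling-⊕C4 : ∀ {m} (H : Graph m) → APSumLabelling H → APSumLabelling (H ⊕ C4)
apSumLabelling-⊕C4 H (lab , (inj , pos , sums) , (suc x′ , d , _ , 1≤d , x∈ , x+d∈ , x+2d∈ , d∉)) =
  AddC4.apSumLabelling H lab inj pos sums x′ d 1≤d x∈ x+d∈ x+2d∈ d∉

proposition8 : (n : ℕ) (G : Graph n)
    → NoIsolated G
    → MinDegreeIs G 2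
    → SumNumberIs G 2
    → Σ (Fin-labels (G ⊕ N 2)) (λ lab → IsSumLabelling (G ⊕ N 2) lab × HasNonTrivialAP lab)
    → Σ (Fin-labels (G ⊕ C4 ⊕ N 2)) (λ lab → IsSumLabelling (G ⊕ C4 ⊕ N 2) lab × HasNonTrivialAP lab)
proposition8 n G _ _ _ = apSumLabelling-⊕-swap G C4 (N 2) ∘ apSumLabelling-⊕C4 (G ⊕ N 2)
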